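{- Let $n,k,s,t,i$ be positive integers with $t\ge 3$, $(t+1)(k-t+1)\le n$, $t+3\le s\le 2k-t$ and $\max\{t+1,\,s+t-k\}\le i\le \min\{k,\frac{s+t}{2}\}$, and suppose $(s,i,t)\ne(6,4,3)$. Define \[ S_1=s(n-s+1)-i(k-i),\qquad S_2=s(n-s+1)-(s+t-i)(k+i-s-t), \] \[ T_1=i(n-k-s+i+1)+(s-i)(k-i+1),\qquad T_2=(s+t-i)(n-k-i+t+1)+(i-t)(k-s-t+i+1). \] Then \[ \frac{(k-i+1)(k+i+1-s-t)S_1S_2}{(n-s+1)^2T_1T_2}>\frac{\binom{n-s}{k-i}\binom{n-s}{k+i-s-t}}{\binom{n-s}{k-i+1}\binom{n-s}{k+i+1-s-t}}. \] -}

module Defs where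

open import Data.Nat as ℕ using (ℕ; zero; suc)
open import Data.Integer as ℤ using (ℤ; +_; -[1+_]; _-_; _*_)
open import Data.Rational as ℚ using (ℚ; _/_)
open import Data.Nat.Combinatorics using (_C_)

-- The rational number a / b, for integers a and b (b ≠ 0).
-- Convention: the value for b = 0 is 0 (never used under the hypotheses
-- of the theorem, where all denominators are positive).
frac : ℤ → ℤ → ℚ
frac a (+ zero)    = ℚ.0ℚ
frac a (+ suc m)   = a / suc m
frac a -[1+ m ]    = ℤ.- a / suc m

-- Binomial coefficient on integer arguments: C(a, b) for a, b ≥ 0, and 0
-- if b < 0 (a ≥ 0 always holds in the theorem).
binom : ℤ → ℤ → ℤ
binom (+ a) (+ b) = + (a C b)
binom _     _     = + 0

module _ (n k s t i : ℤ) where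
  S₁ : ℤ
  S₁ = s * (n - s ℤ.+ + 1) - i * (k - i)

  S₂ : ℤ
  S₂ = s * (n - s ℤ.+ + 1) - (s ℤ.+ t - i) * (k ℤ.+ i - s - t)

  T₁ : ℤ
  T₁ = i * (n - k - s ℤ.+ i ℤ.+ + 1) ℤ.+ (s - i) * (k - i ℤ.+ + 1)

  T₂ : ℤ
  T₂ = (s ℤ.+ t - i) * (n - k - i ℤ.+ t ℤ.+ + 1) ℤ.+ (i - t) * (k - s - t ℤ.+ i ℤ.+ + 1)

  LHS : ℚ
  LHS = frac ((k - i ℤ.+ + 1) * (k ℤ.+ i ℤ.+ + 1 - s - t) * S₁ * S₂)
             ((n - s ℤ.+ + 1) * (n - s ℤ.+ + 1) * T₁ * T₂)

  RHS : ℚ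
  RHS = frac (binom (n - s) (k - i) * binom (n - s) (k ℤ.+ i - s - t))
             (binom (n - s) (k - i ℤ.+ + 1) * binom (n - s) (k ℤ.+ i ℤ.+ + 1 - s - t))

{-# OPTIONS --safe #-}
module Submission where

-- With N = n - s, a = k - i and b = k + i - s - t, the absorption identity
-- (a + 1) C(N, a + 1) = (N - a) C(N, a) turns the right-hand side into
-- (a + 1)(b + 1) / ((N - a)(N - b)); after cancelling (a + 1)(b + 1) the claim becomes the
-- polynomial inequality (n - s + 1)² T₁ T₂ < S₁ S₂ (N - a)(N - b).  Write the hypotheses with
-- slack variables x, y, w, b, r ≥ 0:
--   t = 3 + x,  i = t + 1 + y,  s = 2i - t + w,  k = s + t - i + b,  n = (t + 1)(k - t + 1) + r.
-- This inequality and its side conditions (0 ≤ a, b < N and T₁ T₂ > 0) then state that certain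
-- polynomials in the slacks are positive, and in each of the cases y ≥ 1; y = 0, w ≥ 2; and
-- y = 0, w = 1, x ≥ 1 these polynomials minus 1 have only nonnegative coefficients, as the ring
-- solver's normal form shows.  The remaining cases are s = t + 2, excluded by s ≥ t + 3, and
-- (s, i, t) = (6, 4, 3).

open import Data.Bool.Base using (Bool; true; T; _∧_)
open import Data.Bool.Properties using (T-∧)
open import Data.Empty using (⊥-elim)
open import Data.Fin.Base using (zero; suc)
open import Data.List.Kleene using (_+; _*; ∹_; _&_; [])
open import Data.Nat.Base as ℕ using (ℕ; zero; suc; z≤n; s≤s)
import Data.Nat.Properties as ℕ
open import Data.Nat.Combinatorics using (_C_; nC1≡n; nCk+nC[k+1]≡[n+1]C[k+1])
import Data.Nat.Tactic.RingSolver as ℕ-Solver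
open import Data.Integer.Base as ℤ using (ℤ; +_; +[1+_]; 0ℤ; 1ℤ; +≤+; +<+; positive)
import Data.Integer.Properties as ℤ
open import Data.Integer.Tactic.RingSolver using (ring; solve-∀)
import Data.Rational as Q
import Data.Rational.Properties as Q
import Data.Rational.Unnormalised as ℚᵘ
import Data.Rational.Unnormalised.Properties as ℚᵘ
open import Data.Product.Base using (_×_; _,_; proj₁; proj₂; ∃-syntax)
open import Data.Vec.Base using (Vec; []; _∷_; map)
open import Data.Vec.Relation.Unary.All using (All; []; _∷_)
open import Function.Bundles using (Equivalence)
open import Relation.Nullary using (¬_)
open import Relation.Binary.PropositionalEquality

open import Tactic.RingSolver.NonReflective ring using (module Ops)
open import Tactic.RingSolver.Core.Expression using (Expr; Κ; Ι; _⊕_; _⊗_; ⊝_)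
open import Tactic.RingSolver.Core.Polynomial.Parameters using (module Homomorphism)
open Ops using (homo; norm; correct) renaming (⟦_⟧ to ⟦_⟧ᴱ)
open import Tactic.RingSolver.Core.Polynomial.Base (Homomorphism.from homo)
open import Tactic.RingSolver.Core.Polynomial.Semantics homo renaming (⟦_⟧ to ⟦_⟧ₚ)
open import Algebra.Properties.Semiring.Exp.TCOptimised (Homomorphism.semiring homo) using (_^_)

open import Defs

module _ where
  open import Data.Nat.Base using (_+_; _*_)
  open ≡-Reasoning

  [1+k]*nC[1+k]+k*nCk≡n*nCk : ∀ n k → suc k * (n C (suc k)) + k * (n C k) ≡ n * (n C k)
  [1+k]*nC[1+k]+k*nCk≡n*nCk zero    zero    = refl
  [1+k]*nC[1+k]+k*nCk≡n*nCk zero    (suc k) =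
    cong₂ _+_ (ℕ.*-zeroʳ (suc (suc k))) (ℕ.*-zeroʳ (suc k))
  [1+k]*nC[1+k]+k*nCk≡n*nCk (suc m) zero    = begin
      1 * (suc m C 1) + 0  ≡⟨ ℕ.+-identityʳ _ ⟩
      1 * (suc m C 1)      ≡⟨ ℕ.*-identityˡ _ ⟩
      suc m C 1            ≡⟨ nC1≡n (suc m) ⟩
      suc m                ≡⟨ ℕ.*-identityʳ (suc m) ⟨
      suc m * 1            ∎
  [1+k]*nC[1+k]+k*nCk≡n*nCk (suc m) (suc j) = begin
      suc k * (suc m C (suc k)) + k * (suc m C k)
    ≡⟨ cong₂ (λ x y → suc k * x + k * y) (sym (nCk+nC[k+1]≡[n+1]C[k+1] m k))
                                         (sym (nCk+nC[k+1]≡[n+1]C[k+1] m j)) ⟩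
      suc k * (c₁ + c₂) + k * (c₀ + c₁)
    ≡⟨ regroup j c₀ c₁ c₂ ⟩
      (suc k * c₂ + k * c₁) + (k * c₁ + j * c₀) + (c₀ + c₁)
    ≡⟨ cong₂ (λ x y → x + y + (c₀ + c₁)) ([1+k]*nC[1+k]+k*nCk≡n*nCk m k)
                                         ([1+k]*nC[1+k]+k*nCk≡n*nCk m j) ⟩
      m * c₁ + m * c₀ + (c₀ + c₁)
    ≡⟨ collect m c₀ c₁ ⟩
      suc m * (c₀ + c₁)
    ≡⟨ cong (suc m *_) (nCk+nC[k+1]≡[n+1]C[k+1] m j) ⟩
      suc m * (suc m C k)
    ∎
    where
    k c₀ c₁ c₂ : ℕ
    k = suc j
    c₀ = m C j
    c₁ = m C k
    c₂ = m C (suc k)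
    regroup : ∀ j a b c → suc (suc j) * (b + c) + suc j * (a + b)
                         ≡ (suc (suc j) * c + suc j * b) + (suc j * b + j * a) + (a + b)
    regroup = ℕ-Solver.solve-∀
    collect : ∀ m a b → m * b + m * a + (a + b) ≡ suc m * (a + b)
    collect = ℕ-Solver.solve-∀

open import Data.Integer.Base using (_+_; _*_; _-_; _≤_; _<_)

nonNegCoeffs  : ∀ {n} → Poly n → Bool
nonNegCoeffs+ : ∀ {n} → Coeff n + → Bool
nonNegCoeffs* : ∀ {n} → Coeff n * → Bool
nonNegCoeffs (Κ x ⊐ _)  = 0ℤ ℤ.≤ᵇ x
nonNegCoeffs (⅀ xs ⊐ _) = nonNegCoeffs+ xs
nonNegCoeffs+ (x ≠0 Δ _ & xs) = nonNegCoeffs x ∧ nonNegCoeffs* xs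
nonNegCoeffs* []     = true
nonNegCoeffs* (∹ xs) = nonNegCoeffs+ xs

0≤i*j : ∀ {i j} → 0ℤ ≤ i → 0ℤ ≤ j → 0ℤ ≤ i * j
0≤i*j {+ m} {+ n} _ _ = subst (0ℤ ≤_) (ℤ.pos-* m n) (+≤+ z≤n)

0≤i^n : ∀ {i} n → 0ℤ ≤ i → 0ℤ ≤ i ^ n
0≤i^n zero          _   = +≤+ z≤n
0≤i^n (suc zero)    0≤i = 0≤i
0≤i^n (suc (suc n)) 0≤i = 0≤i*j (0≤i^n (suc n) 0≤i) 0≤i

*⟨⟩^-nonNeg : ∀ {x ρ} i → 0ℤ ≤ ρ → 0ℤ ≤ x → 0ℤ ≤ x *⟨ ρ ⟩^ i
*⟨⟩^-nonNeg zero    _   0≤x = 0≤x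
*⟨⟩^-nonNeg (suc i) 0≤ρ 0≤x = 0≤i*j (0≤i^n (suc i) 0≤ρ) 0≤x

drop-nonNeg : ∀ {i n} (i≤n : i ℕ.≤′ n) {ρ : Vec ℤ n} →
              All (0ℤ ≤_) ρ → All (0ℤ ≤_) (drop i≤n ρ)
drop-nonNeg ℕ.≤′-refl       ρ⁺       = ρ⁺
drop-nonNeg (ℕ.≤′-step i≤n) (_ ∷ ρ⁺) = drop-nonNeg i≤n ρ⁺

⟦⟧ₚ-nonNeg : ∀ {n} (p : Poly n) {ρ} → All (0ℤ ≤_) ρ → T (nonNegCoeffs p) → 0ℤ ≤ ⟦ p ⟧ₚ ρ
⅀⟦⟧-nonNeg : ∀ {n} (xs : Coeff n +) {ρ ρs} → 0ℤ ≤ ρ → All (0ℤ ≤_) ρs →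
             T (nonNegCoeffs+ xs) → 0ℤ ≤ ⅀⟦ xs ⟧ (ρ , ρs)
⟦∷⟧-nonNeg : ∀ {n} (x : Poly n) (xs : Coeff n *) {ρ ρs} → 0ℤ ≤ ρ → All (0ℤ ≤_) ρs →
             T (nonNegCoeffs x) → T (nonNegCoeffs* xs) → 0ℤ ≤ (x , xs) ⟦∷⟧ (ρ , ρs)
⟦⟧ₚ-nonNeg (Κ x ⊐ _) _ x⁺ = ℤ.≤ᵇ⇒≤ x⁺
⟦⟧ₚ-nonNeg (⅀ xs ⊐ i≤n) {ρ} ρ⁺ xs⁺ with drop i≤n ρ | drop-nonNeg i≤n ρ⁺
... | _ ∷ _ | ρ₀⁺ ∷ ρs⁺ = ⅀⟦⟧-nonNeg xs ρ₀⁺ ρs⁺ xs⁺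
⅀⟦⟧-nonNeg (x ≠0 Δ i & xs) ρ⁺ ρs⁺ x,xs⁺ =
  *⟨⟩^-nonNeg i ρ⁺ (⟦∷⟧-nonNeg x xs ρ⁺ ρs⁺ (proj₁ x⁺,xs⁺) (proj₂ x⁺,xs⁺))
  where
  x⁺,xs⁺ : T (nonNegCoeffs x) × T (nonNegCoeffs* xs)
  x⁺,xs⁺ = Equivalence.to T-∧ x,xs⁺
⟦∷⟧-nonNeg x []     _  ρs⁺ x⁺ _   = ⟦⟧ₚ-nonNeg x ρs⁺ x⁺
⟦∷⟧-nonNeg x (∹ xs) ρ⁺ ρs⁺ x⁺ xs⁺ =
  ℤ.+-mono-≤ (0≤i*j ρ⁺ (⅀⟦⟧-nonNeg xs ρ⁺ ρs⁺ xs⁺)) (⟦⟧ₚ-nonNeg x ρs⁺ x⁺)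

infixl 6 _⊖_
_⊖_ : ∀ {n} → Expr ℤ n → Expr ℤ n → Expr ℤ n
e ⊖ f = e ⊕ ⊝ f

infix 4 _≤ᶜ_ _<ᶜ_
_≤ᶜ_ _<ᶜ_ : ∀ {n} → Expr ℤ n → Expr ℤ n → Set
e ≤ᶜ f = T (nonNegCoeffs (norm (f ⊖ e)))
e <ᶜ f = Κ 1ℤ ⊕ e ≤ᶜ f

≤ᶜ⇒≤ : ∀ {n} (e f : Expr ℤ n) → e ≤ᶜ f → ∀ {ρ} → All (0ℤ ≤_) ρ → ⟦ e ⟧ᴱ ρ ≤ ⟦ f ⟧ᴱ ρ
≤ᶜ⇒≤ e f e≤ᶜf {ρ} ρ⁺ =
  ℤ.0≤i-j⇒j≤i (subst (0ℤ ≤_) (correct (f ⊖ e) ρ) (⟦⟧ₚ-nonNeg (norm (f ⊖ e)) ρ⁺ e≤ᶜf))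

<ᶜ⇒< : ∀ {n} (e f : Expr ℤ n) → e <ᶜ f → ∀ {ρ} → All (0ℤ ≤_) ρ → ⟦ e ⟧ᴱ ρ < ⟦ f ⟧ᴱ ρ
<ᶜ⇒< e f e<ᶜf ρ⁺ = ℤ.suc[i]≤j⇒i<j (≤ᶜ⇒≤ (Κ 1ℤ ⊕ e) f e<ᶜf ρ⁺)

All-nonNeg-map-+ : ∀ {n} (xs : Vec ℕ n) → All (0ℤ ≤_) (map +_ xs)
All-nonNeg-map-+ []       = []
All-nonNeg-map-+ (_ ∷ xs) = +≤+ z≤n ∷ All-nonNeg-map-+ xs

binom-pos : ∀ {N a} → 0ℤ ≤ a → a ≤ N → 0ℤ < binom N a
binom-pos (+≤+ _) (+≤+ a≤N) = +<+ (nCk>0 a≤N)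
  where
  nCk>0 : ∀ {n k} → k ℕ.≤ n → 0 ℕ.< n C k
  nCk>0 {_}     {zero}  _         = s≤s z≤n
  nCk>0 {suc m} {suc k} (s≤s k≤m) =
    subst (0 ℕ.<_) (nCk+nC[k+1]≡[n+1]C[k+1] m k) (ℕ.<-≤-trans (nCk>0 k≤m) (ℕ.m≤m+n _ _))

binom-absorb : ∀ {N a} → 0ℤ ≤ N → 0ℤ ≤ a → (a + 1ℤ) * binom N (a + 1ℤ) ≡ (N - a) * binom N a
binom-absorb {+ N} {+ a} _ _ = begin
    (+ a + 1ℤ) * binom (+ N) (+ a + 1ℤ)
  ≡⟨ cong (λ b → b * binom (+ N) b) (ℤ.+-comm (+ a) 1ℤ) ⟩
    + suc a * + (N C (suc a))
  ≡⟨ x≡[x+y]-y (+ suc a * + (N C (suc a))) (+ a * + (N C a)) ⟩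
    (+ suc a * + (N C (suc a)) + + a * + (N C a)) - + a * + (N C a)
  ≡⟨ cong (_- + a * + (N C a)) absorption ⟩
    + N * + (N C a) - + a * + (N C a)
  ≡⟨ [x-y]*z≡x*z-y*z (+ N) (+ a) (+ (N C a)) ⟨
    (+ N - + a) * + (N C a)
  ∎
  where
  open ≡-Reasoning
  x≡[x+y]-y : ∀ x y → x ≡ x + y - y
  x≡[x+y]-y = solve-∀
  [x-y]*z≡x*z-y*z : ∀ x y z → (x - y) * z ≡ x * z - y * z
  [x-y]*z≡x*z-y*z = solve-∀
  absorption : + suc a * + (N C (suc a)) + + a * + (N C a) ≡ + N * + (N C a)
  absorption = begin
      + suc a * + (N C (suc a)) + + a * + (N C a)
    ≡⟨ cong₂ _+_ (ℤ.pos-* (suc a) _) (ℤ.pos-* a _) ⟨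
      + (suc a ℕ.* (N C (suc a))) + + (a ℕ.* (N C a))
    ≡⟨ ℤ.pos-+ (suc a ℕ.* (N C (suc a))) (a ℕ.* (N C a)) ⟨
      + (suc a ℕ.* (N C (suc a)) ℕ.+ a ℕ.* (N C a))
    ≡⟨ cong +_ ([1+k]*nC[1+k]+k*nCk≡n*nCk N a) ⟩
      + (N ℕ.* (N C a))
    ≡⟨ ℤ.pos-* N _ ⟩
      + N * + (N C a)
    ∎

frac-< : ∀ {p₁ q₁ p₂ q₂} → 0ℤ < q₁ → 0ℤ < q₂ → p₁ * q₂ < p₂ * q₁ → frac p₁ q₁ Q.< frac p₂ q₂
frac-< {p₁} {+[1+ m₁ ]} {p₂} {+[1+ m₂ ]} (+<+ (s≤s z≤n)) (+<+ (s≤s z≤n)) p₁q₂<p₂q₁ =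
  Q.toℚᵘ-cancel-<
    (ℚᵘ.<-respˡ-≃ (ℚᵘ.≃-sym (Q.toℚᵘ-fromℚᵘ (ℚᵘ.mkℚᵘ p₁ m₁)))
      (ℚᵘ.<-respʳ-≃ (ℚᵘ.≃-sym (Q.toℚᵘ-fromℚᵘ (ℚᵘ.mkℚᵘ p₂ m₂))) (ℚᵘ.*<* p₁q₂<p₂q₁)))

0<i*j : ∀ {i j} → 0ℤ < i → 0ℤ < j → 0ℤ < i * j
0<i*j {+[1+ _ ]} {+[1+ _ ]} (+<+ (s≤s z≤n)) (+<+ (s≤s z≤n)) = +<+ (s≤s z≤n)

binom-ratio-< : ∀ {N a b P₁ P₂ Q} → 0ℤ ≤ a → 0ℤ ≤ b → a < N → b < N → 0ℤ < Q →
                Q < P₁ * P₂ * (N - a) * (N - b) →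
                frac (binom N a * binom N b) (binom N (a + 1ℤ) * binom N (b + 1ℤ))
                  Q.< frac ((a + 1ℤ) * (b + 1ℤ) * P₁ * P₂) Q
binom-ratio-< {N} {a} {b} {P₁} {P₂} {Q} 0≤a 0≤b a<N b<N 0<Q Q<P =
  frac-< (0<i*j (binom-succ-pos 0≤a a<N) (binom-succ-pos 0≤b b<N)) 0<Q (begin-strict
    binom N a * binom N b * Q
      <⟨ ℤ.*-monoˡ-<-pos (binom N a * binom N b) {{positive 0<cₐc_b}} Q<P ⟩
    binom N a * binom N b * (P₁ * P₂ * (N - a) * (N - b))
      ≡⟨ regroup (binom N a) (binom N b) (P₁ * P₂) (N - a) (N - b) ⟩
    P₁ * P₂ * ((N - a) * binom N a) * ((N - b) * binom N b)
      ≡⟨ cong₂ (λ x y → P₁ * P₂ * x * y) (binom-absorb 0≤N 0≤a) (binom-absorb 0≤N 0≤b) ⟨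
    P₁ * P₂ * ((a + 1ℤ) * binom N (a + 1ℤ)) * ((b + 1ℤ) * binom N (b + 1ℤ))
      ≡⟨ collect (a + 1ℤ) (b + 1ℤ) P₁ P₂ (binom N (a + 1ℤ)) (binom N (b + 1ℤ)) ⟩
    (a + 1ℤ) * (b + 1ℤ) * P₁ * P₂ * (binom N (a + 1ℤ) * binom N (b + 1ℤ)) ∎)
  where
  open ℤ.≤-Reasoning
  0≤N : 0ℤ ≤ N
  0≤N = ℤ.≤-trans 0≤a (ℤ.<⇒≤ a<N)
  0<cₐc_b : 0ℤ < binom N a * binom N b
  0<cₐc_b = 0<i*j (binom-pos 0≤a (ℤ.<⇒≤ a<N)) (binom-pos 0≤b (ℤ.<⇒≤ b<N))
  binom-succ-pos : ∀ {x} → 0ℤ ≤ x → x < N → 0ℤ < binom N (x + 1ℤ)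
  binom-succ-pos {x} 0≤x x<N = binom-pos (ℤ.≤-trans 0≤x (ℤ.i≤i+j x 1ℤ))
                                         (subst (_≤ N) (ℤ.+-comm 1ℤ x) (ℤ.i<j⇒suc[i]≤j x<N))
  regroup : ∀ c d p u v → c * d * (p * u * v) ≡ p * (u * c) * (v * d)
  regroup = solve-∀
  collect : ∀ α β p₁ p₂ x y → p₁ * p₂ * (α * x) * (β * y) ≡ α * β * p₁ * p₂ * (x * y)
  collect = solve-∀

module _ (n k s t i : ℤ) where
  lhsDenominator : ℤ
  lhsDenominator = (n - s + 1ℤ) * (n - s + 1ℤ) * T₁ n k s t i * T₂ n k s t i

  clearedNumerator : ℤ
  clearedNumerator = S₁ n k s t i * S₂ n k s t i * (n - s - (k - i)) * (n - s - (k + i - s - t))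

cleared⇒RHS<LHS : ∀ {n k s t i} → 0ℤ ≤ k - i → 0ℤ ≤ k + i - s - t →
                  k - i < n - s → k + i - s - t < n - s → 0ℤ < lhsDenominator n k s t i →
                  lhsDenominator n k s t i < clearedNumerator n k s t i →
                  RHS n k s t i Q.< LHS n k s t i
cleared⇒RHS<LHS {n} {k} {s} {t} {i} 0≤a 0≤b a<N b<N 0<Q Q<P =
  subst (λ β → frac (binom N a * binom N b) (binom N (a + 1ℤ) * binom N β)
                 Q.< frac ((a + 1ℤ) * β * S₁ n k s t i * S₂ n k s t i) (lhsDenominator n k s t i))
        (b+1≡ k i s t)
        (binom-ratio-< 0≤a 0≤b a<N b<N 0<Q Q<P)
  where
  N a b : ℤ
  N = n - s
  a = k - i
  b = k + i - s - t
  b+1≡ : ∀ k i s t → k + i - s - t + 1ℤ ≡ k + i + 1ℤ - s - t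
  b+1≡ = solve-∀

module Syntax {m} (n k s t i : Expr ℤ m) where
  S₁ᴱ S₂ᴱ T₁ᴱ T₂ᴱ lhsDenominatorᴱ clearedNumeratorᴱ : Expr ℤ m
  S₁ᴱ = s ⊗ (n ⊖ s ⊕ Κ 1ℤ) ⊖ i ⊗ (k ⊖ i)
  S₂ᴱ = s ⊗ (n ⊖ s ⊕ Κ 1ℤ) ⊖ (s ⊕ t ⊖ i) ⊗ (k ⊕ i ⊖ s ⊖ t)
  T₁ᴱ = i ⊗ (n ⊖ k ⊖ s ⊕ i ⊕ Κ 1ℤ) ⊕ (s ⊖ i) ⊗ (k ⊖ i ⊕ Κ 1ℤ)
  T₂ᴱ = (s ⊕ t ⊖ i) ⊗ (n ⊖ k ⊖ i ⊕ t ⊕ Κ 1ℤ) ⊕ (i ⊖ t) ⊗ (k ⊖ s ⊖ t ⊕ i ⊕ Κ 1ℤ)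
  lhsDenominatorᴱ = (n ⊖ s ⊕ Κ 1ℤ) ⊗ (n ⊖ s ⊕ Κ 1ℤ) ⊗ T₁ᴱ ⊗ T₂ᴱ
  clearedNumeratorᴱ = S₁ᴱ ⊗ S₂ᴱ ⊗ (n ⊖ s ⊖ (k ⊖ i)) ⊗ (n ⊖ s ⊖ (k ⊕ i ⊖ s ⊖ t))

  RHS<LHS-certified : Κ 0ℤ ≤ᶜ k ⊖ i → Κ 0ℤ ≤ᶜ k ⊕ i ⊖ s ⊖ t →
                      k ⊖ i <ᶜ n ⊖ s → k ⊕ i ⊖ s ⊖ t <ᶜ n ⊖ s →
                      Κ 0ℤ <ᶜ lhsDenominatorᴱ → lhsDenominatorᴱ <ᶜ clearedNumeratorᴱ →
                      ∀ {ρ} → All (0ℤ ≤_) ρ →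
                      RHS (⟦ n ⟧ᴱ ρ) (⟦ k ⟧ᴱ ρ) (⟦ s ⟧ᴱ ρ) (⟦ t ⟧ᴱ ρ) (⟦ i ⟧ᴱ ρ)
                        Q.< LHS (⟦ n ⟧ᴱ ρ) (⟦ k ⟧ᴱ ρ) (⟦ s ⟧ᴱ ρ) (⟦ t ⟧ᴱ ρ) (⟦ i ⟧ᴱ ρ)
  -- The implicit arguments must be supplied: inferring them makes Agda unfold ⟦_⟧ᴱ
  -- through the integer arithmetic, which exhausts memory.
  RHS<LHS-certified 0≤a 0≤b a<N b<N 0<Q Q<P {ρ} ρ⁺ =
    cleared⇒RHS<LHS {⟦ n ⟧ᴱ ρ} {⟦ k ⟧ᴱ ρ} {⟦ s ⟧ᴱ ρ} {⟦ t ⟧ᴱ ρ} {⟦ i ⟧ᴱ ρ}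
      (≤ᶜ⇒≤ (Κ 0ℤ) (k ⊖ i) 0≤a ρ⁺)
      (≤ᶜ⇒≤ (Κ 0ℤ) (k ⊕ i ⊖ s ⊖ t) 0≤b ρ⁺)
      (<ᶜ⇒< (k ⊖ i) (n ⊖ s) a<N ρ⁺)
      (<ᶜ⇒< (k ⊕ i ⊖ s ⊖ t) (n ⊖ s) b<N ρ⁺)
      (<ᶜ⇒< (Κ 0ℤ) lhsDenominatorᴱ 0<Q ρ⁺)
      (<ᶜ⇒< lhsDenominatorᴱ clearedNumeratorᴱ Q<P ρ⁺)

xᴱ yᴱ wᴱ bᴱ rᴱ : Expr ℤ 5
xᴱ = Ι zero
yᴱ = Ι (suc zero)
wᴱ = Ι (suc (suc zero))
bᴱ = Ι (suc (suc (suc zero)))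
rᴱ = Ι (suc (suc (suc (suc zero))))

-- Each expression evaluates definitionally to the form produced by ≤⇒≡+, ≤+⇒≡-+ and -≤⇒≡-+
-- below, so that the main theorem can match their equations against refl.
module Family (tᴱ δᵢ δₛ : Expr ℤ 5) where
  iᴱ sᴱ kᴱ nᴱ : Expr ℤ 5
  iᴱ = tᴱ ⊕ Κ 1ℤ ⊕ δᵢ
  sᴱ = Κ (+ 2) ⊗ iᴱ ⊖ tᴱ ⊕ δₛ
  kᴱ = sᴱ ⊕ tᴱ ⊖ iᴱ ⊕ bᴱ
  nᴱ = (tᴱ ⊕ Κ 1ℤ) ⊗ (kᴱ ⊖ tᴱ ⊕ Κ 1ℤ) ⊕ rᴱ

  open Syntax nᴱ kᴱ sᴱ tᴱ iᴱ public

  RHS<LHS-for-all-slacks : Set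
  RHS<LHS-for-all-slacks = (xs : Vec ℕ 5) → let ρ = map +_ xs in
    RHS (⟦ nᴱ ⟧ᴱ ρ) (⟦ kᴱ ⟧ᴱ ρ) (⟦ sᴱ ⟧ᴱ ρ) (⟦ tᴱ ⟧ᴱ ρ) (⟦ iᴱ ⟧ᴱ ρ)
      Q.< LHS (⟦ nᴱ ⟧ᴱ ρ) (⟦ kᴱ ⟧ᴱ ρ) (⟦ sᴱ ⟧ᴱ ρ) (⟦ tᴱ ⟧ᴱ ρ) (⟦ iᴱ ⟧ᴱ ρ)

RHS<LHS-i≥t+2 : Family.RHS<LHS-for-all-slacks (Κ (+ 3) ⊕ xᴱ) (Κ 1ℤ ⊕ yᴱ) wᴱ
RHS<LHS-i≥t+2 xs =
  Family.RHS<LHS-certified (Κ (+ 3) ⊕ xᴱ) (Κ 1ℤ ⊕ yᴱ) wᴱ _ _ _ _ _ _ (All-nonNeg-map-+ xs)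

RHS<LHS-i≡t+1-s≥t+4 : Family.RHS<LHS-for-all-slacks (Κ (+ 3) ⊕ xᴱ) (Κ 0ℤ) (Κ (+ 2) ⊕ wᴱ)
RHS<LHS-i≡t+1-s≥t+4 xs =
  Family.RHS<LHS-certified (Κ (+ 3) ⊕ xᴱ) (Κ 0ℤ) (Κ (+ 2) ⊕ wᴱ) _ _ _ _ _ _ (All-nonNeg-map-+ xs)

RHS<LHS-i≡t+1-s≡t+3-t≥4 : Family.RHS<LHS-for-all-slacks (Κ (+ 4) ⊕ xᴱ) (Κ 0ℤ) (Κ 1ℤ)
RHS<LHS-i≡t+1-s≡t+3-t≥4 xs =
  Family.RHS<LHS-certified (Κ (+ 4) ⊕ xᴱ) (Κ 0ℤ) (Κ 1ℤ) _ _ _ _ _ _ (All-nonNeg-map-+ xs)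

≤⇒≡+ : ∀ {a b} → a ≤ b → ∃[ m ] b ≡ a + + m
≤⇒≡+ {a} {b} a≤b = ℤ.∣ b - a ∣ , (begin
    b                   ≡⟨ b≡a+[b-a] a b ⟩
    a + (b - a)         ≡⟨ cong (λ x → a + x) (ℤ.0≤i⇒+∣i∣≡i (ℤ.i≤j⇒0≤j-i a≤b)) ⟨
    a + + ℤ.∣ b - a ∣   ∎)
  where
  open ≡-Reasoning
  b≡a+[b-a] : ∀ a b → b ≡ a + (b - a)
  b≡a+[b-a] = solve-∀

≤+⇒≡-+ : ∀ {a} b c → a ≤ b + c → ∃[ m ] b ≡ a - c + + m
≤+⇒≡-+ {a} b c a≤b+c with ≤⇒≡+ a≤b+c
... | m , b+c≡a+m =
  m , trans (b≡b+c-c b c) (trans (cong (_- c) b+c≡a+m) (a+m-c≡a-c+m a (+ m) c))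
  where
  b≡b+c-c : ∀ b c → b ≡ b + c - c
  b≡b+c-c = solve-∀
  a+m-c≡a-c+m : ∀ a m c → a + m - c ≡ a - c + m
  a+m-c≡a-c+m = solve-∀

-≤⇒≡-+ : ∀ a b {c} → a - b ≤ c → ∃[ m ] b ≡ a - c + + m
-≤⇒≡-+ a b {c} a-b≤c with ≤⇒≡+ a-b≤c
... | m , c≡a-b+m =
  m , trans (b≡a-[a-b+m]+m a b (+ m)) (cong (λ x → a - x + + m) (sym c≡a-b+m))
  where
  b≡a-[a-b+m]+m : ∀ a b m → b ≡ a - (a - b + m) + m
  b≡a-[a-b+m]+m = solve-∀

theorem3p2 : (n k s t i : ℤ) →
    + 0 < n → + 0 < k → + 0 < s → + 0 < t → + 0 < i →
    + 3 ≤ t →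
    (t + + 1) * (k - t + + 1) ≤ n →
    t + + 3 ≤ s → s ≤ + 2 * k - t →
    t + + 1 ≤ i → s + t - k ≤ i →
    i ≤ k → + 2 * i ≤ s + t →
    ¬ ((s ≡ + 6) × (i ≡ + 4) × (t ≡ + 3)) →
    RHS n k s t i Q.< LHS n k s t i
theorem3p2 n k s t i _ _ _ _ _ 3≤t n≥ t+3≤s _ t+1≤i s+t-k≤i _ 2i≤s+t not-6-4-3
  with ≤⇒≡+ 3≤t | ≤⇒≡+ t+1≤i | ≤+⇒≡-+ s t 2i≤s+t | -≤⇒≡-+ (s + t) k s+t-k≤i | ≤⇒≡+ n≥
... | x     , refl | suc y , refl | w           , refl | b , refl | r , refl =
  RHS<LHS-i≥t+2 (x ∷ y ∷ w ∷ b ∷ r ∷ [])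
... | x     , refl | zero  , refl | suc (suc w) , refl | b , refl | r , refl =
  RHS<LHS-i≡t+1-s≥t+4 (x ∷ 0 ∷ w ∷ b ∷ r ∷ [])
... | suc x , refl | zero  , refl | suc zero    , refl | b , refl | r , refl =
  RHS<LHS-i≡t+1-s≡t+3-t≥4 (x ∷ 0 ∷ 0 ∷ b ∷ r ∷ [])
... | zero  , refl | zero  , refl | suc zero    , refl | _ , refl | _ , refl =
  ⊥-elim (not-6-4-3 (refl , refl , refl))
... | x     , refl | zero  , refl | zero        , refl | _ , refl | _ , refl =
  ⊥-elim (t+3≰2[t+1]-t (+ 3 + + x) t+3≤s)
  where
  t+3≰2[t+1]-t : ∀ t → ¬ (t + + 3 ≤ + 2 * (t + 1ℤ + 0ℤ) - t + 0ℤ)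
  t+3≰2[t+1]-t t t+3≤s =
    ℤ.<⇒≱ (ℤ.+-monoʳ-< t (+<+ (s≤s (s≤s (s≤s z≤n))))) (subst (t + + 3 ≤_) (2[t+1]-t≡t+2 t) t+3≤s)
    where
    2[t+1]-t≡t+2 : ∀ t → + 2 * (t + 1ℤ + 0ℤ) - t + 0ℤ ≡ t + + 2
    2[t+1]-t≡t+2 = solve-∀
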